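{- Let $n \ge 1$, let $q$ be a prime power, and consider a deterministic decision tree for the discrete span problem (DSPAN) on $\mathbb{F}_q P^n$ that makes at most $h$ queries on every input and is correct on every input. Let $A \subseteq (\mathbb{F}_q P^n)^n$ be the set of inputs reaching some fixed leaf of the tree. Then: (1) there is an $(n-1)$-flat $F \subset \mathbb{F}_q P^n$ with $A \subseteq F^n$; (2) $A = A_1 \times A_2 \times \dots \times A_n$, where each $A_i$ is of the form $G \setminus (G_1 \cup G_2 \cup \dots \cup G_h)$ for some (possibly empty) flats $G, G_1, \dots, G_h$ of $\mathbb{F}_q P^n$.
   Context: $\mathbb{F}_q P^n$ is the $n$-dimensional projective space over $\mathbb{F}_q$ (points are $1$-dimensional linear subspaces of $\mathbb{F}_q^{n+1}$); a flat is the set of points contained in a linear subspace $U$ of $\mathbb{F}_q^{n+1}$, of dimension $\dim U - 1$; an $(n-1)$-flat is a flat of dimension $n-1$. DSPAN: the input is an $n$-tuple $(v_1,\dots,v_n) \in (\mathbb{F}_q P^n)^n$, accessible only through an oracle. A query is an $(n-1)$-flat $x$; the oracle answers YES if $v_1,\dots,v_n \in x$, and otherwise answers with the least index $i \in [n]$ such that $v_i \notin x$. The goal is to output an $(n-1)$-flat containing all $v_i$. A deterministic decision tree for DSPAN is a rooted tree whose internal nodes are labeled by queries, with one child for each possible oracle answer (YES or $i \in [n]$), and whose leaves are labeled by an output $(n-1)$-flat; on an input one follows the oracle answers from the root to a leaf and outputs its label. The tree is correct if for every input the output flat contains $v_1,\dots,v_n$. -}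

module Defs where

open import Level using (0ℓ)
open import Algebra.Bundles using (CommutativeRing)
open import Data.Nat using (ℕ; zero; suc; _^_; _≤_; _<_)
open import Data.Nat.Primality using (Prime)
open import Data.Fin using (Fin; zero; suc; _<_)
open import Data.Product using (Σ; ∃; _×_; _,_)
open import Relation.Nullary using (¬_)
open import Relation.Binary.PropositionalEquality using (_≡_)

IsPrimePower : ℕ → Set
IsPrimePower q = Σ ℕ λ p → Σ ℕ λ k → Prime p × (1 ≤ k) × (q ≡ p ^ k)

record FiniteField (q : ℕ) : Set₁ where
  field
    cring  : CommutativeRing 0ℓ 0ℓ
  open CommutativeRing cring public
  field
    1≉0    : ¬ (1# ≈ 0#)
    inv    : ∀ x → ¬ (x ≈ 0#) → Σ Carrier λ y → x * y ≈ 1#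
    enum   : Fin q → Carrier
    index  : Carrier → Fin q
    enum∘index : ∀ x → enum (index x) ≈ x
    index∘enum : ∀ i → index (enum i) ≡ i
    index-cong : ∀ {x y} → x ≈ y → index x ≡ index y

module Setup {q : ℕ} (F : FiniteField q) (n : ℕ) where
  open FiniteField F using (Carrier; _≈_; _+_; _*_; 0#; 1#)

  Vec : Set
  Vec = Fin (suc n) → Carrier

  _≈V_ : Vec → Vec → Set
  u ≈V w = ∀ j → u j ≈ w j

  zeroV : Vec
  zeroV _ = 0#

  -- a point of F_q P^n is represented by a nonzero vector (the line it spans);
  -- all predicates below are invariant under nonzero scaling.
  IsPoint : Vec → Set
  IsPoint v = ¬ (v ≈V zeroV)

  ∑ : ∀ {k} → (Fin k → Carrier) → Carrier
  ∑ {zero}  f = 0#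
  ∑ {suc k} f = f zero + ∑ (λ i → f (suc i))

  lincomb : ∀ {k} → (Fin k → Carrier) → (Fin k → Vec) → Vec
  lincomb c w t = ∑ (λ j → c j * w j t)

  InSpan : ∀ {k} → Vec → (Fin k → Vec) → Set
  InSpan v w = Σ (Fin _ → Carrier) λ c → v ≈V lincomb c w

  LinIndep : ∀ {k} → (Fin k → Vec) → Set
  LinIndep w = ∀ c → lincomb c w ≈V zeroV → ∀ j → c j ≈ 0#

  -- a flat (of any dimension, possibly empty): the points of the linear
  -- subspace spanned by finitely many vectors
  record Flat : Set where
    constructor flat
    field
      {k}  : ℕ
      gens : Fin k → Vec

  _∈F_ : Vec → Flat → Set
  v ∈F flat g = InSpan v g

  -- an (n-1)-flat: points of a linear subspace U with dim U = n,
  -- given by a basis of U of n linearly independent vectors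
  record Hyperplane : Set where
    constructor hyperplane
    field
      basis : Fin n → Vec
      indep : LinIndep basis

  _∈H_ : Vec → Hyperplane → Set
  v ∈H hyperplane b _ = InSpan v b

  Input : Set
  Input = Fin n → Vec

  ValidInput : Input → Set
  ValidInput v = ∀ i → IsPoint (v i)

  -- deterministic decision trees: internal node = query (n-1)-flat with a
  -- YES child and one child for each answer i ∈ [n]; leaf = output flat
  data Tree : Set where
    leaf : Hyperplane → Tree
    node : Hyperplane → Tree → (Fin n → Tree) → Tree

  data Leaf : Tree → Set where
    here : ∀ {H} → Leaf (leaf H)
    yes  : ∀ {x t ts} → Leaf t → Leaf (node x t ts)
    ans  : ∀ {x t ts} (i : Fin n) → Leaf (ts i) → Leaf (node x t ts)

  label : ∀ {T} → Leaf T → Hyperplane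
  label (here {H}) = H
  label (yes l)    = label l
  label (ans i l)  = label l

  depth : ∀ {T} → Leaf T → ℕ
  depth here      = 0
  depth (yes l)   = suc (depth l)
  depth (ans i l) = suc (depth l)

  data Reaches : (T : Tree) → Input → Leaf T → Set where
    at-leaf : ∀ {H v} → Reaches (leaf H) v here
    go-yes  : ∀ {x t ts v l} → (∀ i → v i ∈H x) →
              Reaches t v l → Reaches (node x t ts) v (yes l)
    go-ans  : ∀ {x t ts v} (i : Fin n) {l : Leaf (ts i)} → ¬ (v i ∈H x) →
              (∀ j → j Data.Fin.< i → v j ∈H x) →
              Reaches (ts i) v l → Reaches (node x t ts) v (ans i l)

  QueriesAtMost : ℕ → Tree → Set
  QueriesAtMost h T = ∀ v (l : Leaf T) → ValidInput v → Reaches T v l → depth l ≤ h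

  Correct : Tree → Set
  Correct T = ∀ v (l : Leaf T) → ValidInput v → Reaches T v l → ∀ i → v i ∈H label l

-- Reaching a leaf l is a conjunction of constraints on each coordinate separately: along the
-- root-to-leaf path, v_i must lie in every query flat answered YES or with an index k > i, and must
-- avoid every query flat answered with i.  Over a finite field the first kind of constraints cut
-- out a flat (spanned by all of its finitely many vectors), and the second kind are at most
-- depth l ≤ h flats, padded with the empty flat.  A leaf deeper than h is reached by no input.
module Submission where

open import Defs
open import Level using (0ℓ)
open import Data.Nat using (ℕ; zero; suc; _^_; _≤_; z≤n; s≤s)
open import Data.Nat.Properties using (≤-trans; ≤-refl; n≤1+n; m≤n⇒m≤1+n; _≤?_)
open import Data.Fin using (Fin; finToFun; funToFin; fromℕ<) renaming (zero to fzero; suc to fsuc)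
open import Data.Fin.Properties using (finToFun-funToFin; all?; any?; _<?_) renaming (_≟_ to _≟ᶠ_)
open import Data.Product using (Σ; _×_; _,_; proj₁; proj₂)
open import Data.List using (List; []; _∷_; length)
open import Data.List.Relation.Unary.All as All using (All; []; _∷_)
open import Data.Empty using (⊥-elim)
open import Function using (_∘_)
open import Function.Bundles using (_⇔_; mk⇔; Equivalence)
import Function.Properties.Equivalence as ⇔
open import Relation.Nullary using (¬_; Dec; yes; no)
open import Relation.Nullary.Decidable using (map′)
open import Relation.Unary using (Pred; Decidable)
open import Relation.Binary.Definitions using (_Respects_)
open import Relation.Binary.PropositionalEquality as ≡ using (_≡_)

module DSpan {q : ℕ} (F : FiniteField q) (n : ℕ) where
  open FiniteField F hiding (zero)
  open Setup F n renaming (yes to yesᴸ)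
  open import Algebra.Properties.Semiring.Sum semiring
    using (sum; sum-cong-≋; sum-replicate-zero; ∑-distrib-+; *-distribˡ-sum)
  open import Relation.Binary.Reasoning.Setoid setoid

  _≟_ : (x y : Carrier) → Dec (x ≈ y)
  x ≟ y = map′ (λ e → trans (sym (enum∘index x)) (trans (reflexive (≡.cong enum e)) (enum∘index y)))
               index-cong (index x ≟ᶠ index y)

  _≈V?_ : (u w : Vec) → Dec (u ≈V w)
  u ≈V? w = all? (λ t → u t ≟ w t)

  ≈V-refl : ∀ {u} → u ≈V u
  ≈V-refl t = refl

  ≈V-sym : ∀ {u w} → u ≈V w → w ≈V u
  ≈V-sym e t = sym (e t)

  ≈V-trans : ∀ {u v w} → u ≈V v → v ≈V w → u ≈V w
  ≈V-trans e e′ t = trans (e t) (e′ t)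

  ∑≡sum : ∀ {k} (f : Fin k → Carrier) → ∑ f ≡ sum f
  ∑≡sum {zero}  f = ≡.refl
  ∑≡sum {suc k} f = ≡.cong (f fzero +_) (∑≡sum (f ∘ fsuc))

  δ : ∀ {k} → Fin k → Fin k → Carrier
  δ fzero    fzero    = 1#
  δ fzero    (fsuc _) = 0#
  δ (fsuc _) fzero    = 0#
  δ (fsuc i) (fsuc j) = δ i j

  module _ {k : ℕ} (g : Fin k → Vec) where

    lincomb-cong : ∀ {a b} → (∀ j → a j ≈ b j) → lincomb a g ≈V lincomb b g
    lincomb-cong {a} {b} e t rewrite ∑≡sum (λ j → a j * g j t) | ∑≡sum (λ j → b j * g j t) =
      sum-cong-≋ (λ j → *-congʳ (e j))

    lincomb-zero : lincomb (λ _ → 0#) g ≈V zeroV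
    lincomb-zero t rewrite ∑≡sum (λ j → 0# * g j t) =
      trans (sum-cong-≋ (λ j → zeroˡ (g j t))) (sum-replicate-zero k)

    lincomb-+ : ∀ a b → lincomb (λ j → a j + b j) g ≈V (λ t → lincomb a g t + lincomb b g t)
    lincomb-+ a b t
      rewrite ∑≡sum (λ j → (a j + b j) * g j t) | ∑≡sum (λ j → a j * g j t) | ∑≡sum (λ j → b j * g j t) =
      trans (sum-cong-≋ (λ j → distribʳ (g j t) (a j) (b j)))
            (∑-distrib-+ (λ j → a j * g j t) (λ j → b j * g j t))

    lincomb-* : ∀ s a → lincomb (λ j → s * a j) g ≈V (λ t → s * lincomb a g t)
    lincomb-* s a t rewrite ∑≡sum (λ j → (s * a j) * g j t) | ∑≡sum (λ j → a j * g j t) =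
      trans (sum-cong-≋ (λ j → *-assoc s (a j) (g j t))) (sym (*-distribˡ-sum s (λ j → a j * g j t)))

  lincomb-δ : ∀ {k} (g : Fin k → Vec) i → lincomb (δ i) g ≈V g i
  lincomb-δ {suc k} g fzero t = begin
    1# * g fzero t + lincomb (λ _ → 0#) (g ∘ fsuc) t
      ≈⟨ +-cong (*-identityˡ _) (lincomb-zero (g ∘ fsuc) t) ⟩
    g fzero t + 0#
      ≈⟨ +-identityʳ _ ⟩
    g fzero t ∎
  lincomb-δ {suc k} g (fsuc i) t =
    trans (+-cong (zeroˡ _) (lincomb-δ (g ∘ fsuc) i t)) (+-identityˡ _)

  IsSubspace : Pred Vec 0ℓ → Set
  IsSubspace P = ∀ {k} (g : Fin k → Vec) c → (∀ j → P (g j)) → P (lincomb c g)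

  module _ {k : ℕ} (g : Fin k → Vec) where

    InSpan-resp : (λ v → InSpan v g) Respects _≈V_
    InSpan-resp u≈w (c , u≈) = c , ≈V-trans (≈V-sym u≈w) u≈

    InSpan-gen : ∀ i → InSpan (g i) g
    InSpan-gen i = δ i , ≈V-sym (lincomb-δ g i)

    InSpan-lincomb : IsSubspace (λ v → InSpan v g)
    InSpan-lincomb {zero}  f c _    = (λ _ → 0#) , ≈V-sym (lincomb-zero g)
    InSpan-lincomb {suc m} f c f∈ with f∈ fzero | InSpan-lincomb (f ∘ fsuc) (c ∘ fsuc) (f∈ ∘ fsuc)
    ... | a , ea | b , eb = (λ j → c fzero * a j + b j) , λ t → begin
      c fzero * f fzero t + lincomb (c ∘ fsuc) (f ∘ fsuc) t ≈⟨ +-cong (*-congˡ (ea t)) (eb t) ⟩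
      c fzero * lincomb a g t + lincomb b g t              ≈⟨ +-congʳ (lincomb-* g (c fzero) a t) ⟨
      lincomb (λ j → c fzero * a j) g t + lincomb b g t    ≈⟨ lincomb-+ g (λ j → c fzero * a j) b t ⟨
      lincomb (λ j → c fzero * a j + b j) g t               ∎

  enumVec : ∀ {k} → Fin (q ^ k) → Fin k → Carrier
  enumVec {k} m = enum ∘ finToFun {q} {k} m

  indexVec : ∀ {k} → (Fin k → Carrier) → Fin (q ^ k)
  indexVec c = funToFin (index ∘ c)

  enumVec∘indexVec : ∀ {k} (c : Fin k → Carrier) j → enumVec (indexVec c) j ≈ c j
  enumVec∘indexVec c j =
    trans (reflexive (≡.cong enum (finToFun-funToFin (index ∘ c) j))) (enum∘index (c j))

  InSpan? : ∀ {k} v (g : Fin k → Vec) → Dec (InSpan v g)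
  InSpan? {k} v g = map′
    (λ (m , e) → enumVec m , e)
    (λ (c , e) → indexVec c , ≈V-trans e (lincomb-cong g (λ j → sym (enumVec∘indexVec c j))))
    (any? λ m → v ≈V? lincomb (enumVec m) g)

  keepIf : ∀ {A : Set} → Dec A → Vec → Vec
  keepIf (yes _) w = w
  keepIf (no _)  _ = zeroV

  keepIf-kept : ∀ {A : Set} (d : Dec A) w → A → keepIf d w ≈V w
  keepIf-kept (yes _) w _ = ≈V-refl
  keepIf-kept (no ¬a) w a = ⊥-elim (¬a a)

  module _ (P : Pred Vec 0ℓ) (P? : Decidable P) where

    membersOf : Fin (q ^ suc n) → Vec
    membersOf m = keepIf (P? (enumVec m)) (enumVec m)

    spanOf : Flat
    spanOf = flat membersOf

    ∈-spanOf : IsSubspace P → P Respects _≈V_ → ∀ {v} → v ∈F spanOf ⇔ P v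
    ∈-spanOf sub resp {v} = mk⇔
      (λ (c , e) → resp (≈V-sym e) (sub membersOf c membersOf∈P))
      (λ v∈P → InSpan-resp membersOf (membersOf≈v v∈P) (InSpan-gen membersOf (indexVec v)))
      where
      membersOf∈P : ∀ m → P (membersOf m)
      membersOf∈P m with P? (enumVec m)
      ... | yes w∈P = w∈P
      ... | no _    = sub {0} (λ ()) (λ ()) (λ ())

      membersOf≈v : P v → membersOf (indexVec v) ≈V v
      membersOf≈v v∈P = ≈V-trans (keepIf-kept (P? (enumVec (indexVec v))) _ w∈P) w≈v
        where
        w≈v : enumVec (indexVec v) ≈V v
        w≈v = enumVec∘indexVec v

        w∈P : P (enumVec (indexVec v))
        w∈P = resp (≈V-sym w≈v) v∈P

  All-∈F-subspace : ∀ Fs → IsSubspace (λ v → All (v ∈F_) Fs)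
  All-∈F-subspace []       g c _  = []
  All-∈F-subspace (G ∷ Fs) g c g∈ =
    InSpan-lincomb (Flat.gens G) g c (All.head ∘ g∈) ∷ All-∈F-subspace Fs g c (All.tail ∘ g∈)

  All-∈F? : ∀ Fs → Decidable (λ v → All (v ∈F_) Fs)
  All-∈F? Fs v = All.all? (λ G → InSpan? v (Flat.gens G)) Fs

  ⋂ : List Flat → Flat
  ⋂ Fs = spanOf _ (All-∈F? Fs)

  ∈-⋂ : ∀ Fs {v} → v ∈F ⋂ Fs ⇔ All (v ∈F_) Fs
  ∈-⋂ Fs = ∈-spanOf _ (All-∈F? Fs) (All-∈F-subspace Fs)
                     (λ e → All.map (λ {G} → InSpan-resp (Flat.gens G) e))

  ∅ : Flat
  ∅ = flat {0} (λ ())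

  point∉∅ : ∀ {v} → IsPoint v → ¬ v ∈F ∅
  point∉∅ v≉0 (_ , v≈0) = v≉0 v≈0

  pad : ∀ {h} (Fs : List Flat) → length Fs ≤ h → Fin h → Flat
  pad []       _         _        = ∅
  pad (G ∷ Fs) (s≤s _)   fzero    = G
  pad (G ∷ Fs) (s≤s l≤h) (fsuc j) = pad Fs l≤h j

  ∉-pad : ∀ {h v} → IsPoint v → (Fs : List Flat) (l≤h : length Fs ≤ h) →
          (∀ j → ¬ v ∈F pad Fs l≤h j) ⇔ All (λ G → ¬ v ∈F G) Fs
  ∉-pad v≉0 []       _         = mk⇔ (λ _ → []) (λ _ _ → point∉∅ v≉0)
  ∉-pad v≉0 (G ∷ Fs) (s≤s l≤h) = mk⇔
    (λ v∉ → v∉ fzero ∷ to (v∉ ∘ fsuc))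
    (λ { (v∉G ∷ _) fzero → v∉G ; (_ ∷ v∉Fs) (fsuc j) → from v∉Fs j })
    where open Equivalence (∉-pad v≉0 Fs l≤h)

  consIf : ∀ {A B : Set} → Dec A → B → List B → List B
  consIf (yes _) x xs = x ∷ xs
  consIf (no _)  _ xs = xs

  length-consIf : ∀ {A B : Set} (d : Dec A) (x : B) xs → length (consIf d x xs) ≤ suc (length xs)
  length-consIf (yes _) _ _  = ≤-refl
  length-consIf (no _)  _ xs = n≤1+n (length xs)

  All-consIf⁺ : ∀ {A B : Set} {Q : Pred B 0ℓ} (d : Dec A) {x xs} → (A → Q x) → All Q xs → All Q (consIf d x xs)
  All-consIf⁺ (yes a) Qx Qxs = Qx a ∷ Qxs
  All-consIf⁺ (no _)  _  Qxs = Qxs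

  All-consIf⁻ : ∀ {A B : Set} {Q : Pred B 0ℓ} (d : Dec A) {x xs} → All Q (consIf d x xs) → (A → Q x) × All Q xs
  All-consIf⁻ (yes _)  (Qx ∷ Qxs) = (λ _ → Qx) , Qxs
  All-consIf⁻ (no ¬a)  Qxs        = (λ a → ⊥-elim (¬a a)) , Qxs

  queryFlat : Hyperplane → Flat
  queryFlat x = flat (Hyperplane.basis x)

  mustContain : ∀ {T} → Leaf T → Fin n → List Flat
  mustContain here              i = []
  mustContain (yesᴸ {x = x} l)  i = queryFlat x ∷ mustContain l i
  mustContain (ans {x = x} k l) i = consIf (i <? k) (queryFlat x) (mustContain l i)

  mustAvoid : ∀ {T} → Leaf T → Fin n → List Flat
  mustAvoid here              i = []
  mustAvoid (yesᴸ l)          i = mustAvoid l i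
  mustAvoid (ans {x = x} k l) i = consIf (i ≟ᶠ k) (queryFlat x) (mustAvoid l i)

  length-mustAvoid≤depth : ∀ {T} (l : Leaf T) i → length (mustAvoid l i) ≤ depth l
  length-mustAvoid≤depth here              i = z≤n
  length-mustAvoid≤depth (yesᴸ l)          i = m≤n⇒m≤1+n (length-mustAvoid≤depth l i)
  length-mustAvoid≤depth (ans {x = x} k l) i =
    ≤-trans (length-consIf (i ≟ᶠ k) (queryFlat x) (mustAvoid l i)) (s≤s (length-mustAvoid≤depth l i))

  SatisfiesPath : ∀ {T} → Leaf T → Input → Set
  SatisfiesPath l v = ∀ i → All (v i ∈F_) (mustContain l i) × All (λ G → ¬ v i ∈F G) (mustAvoid l i)

  Reaches⇒SatisfiesPath : ∀ {T v} {l : Leaf T} → Reaches T v l → SatisfiesPath l v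
  Reaches⇒SatisfiesPath at-leaf           i = [] , []
  Reaches⇒SatisfiesPath (go-yes v∈x r)    i with Reaches⇒SatisfiesPath r i
  ... | inside , outside = v∈x i ∷ inside , outside
  Reaches⇒SatisfiesPath (go-ans k vₖ∉x v<ₖ∈x r) i with Reaches⇒SatisfiesPath r i
  ... | inside , outside =
    All-consIf⁺ (i <? k) (v<ₖ∈x i) inside , All-consIf⁺ (i ≟ᶠ k) (λ { ≡.refl → vₖ∉x }) outside

  SatisfiesPath⇒Reaches : ∀ {T} (l : Leaf T) v → SatisfiesPath l v → Reaches T v l
  SatisfiesPath⇒Reaches here     v s = at-leaf
  SatisfiesPath⇒Reaches (yesᴸ l) v s =
    go-yes (All.head ∘ proj₁ ∘ s) (SatisfiesPath⇒Reaches l v λ i → All.tail (proj₁ (s i)) , proj₂ (s i))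
  SatisfiesPath⇒Reaches (ans k l) v s =
    go-ans k (proj₁ (All-consIf⁻ (k ≟ᶠ k) (proj₂ (s k))) ≡.refl)
             (λ j j<k → proj₁ (All-consIf⁻ (j <? k) (proj₁ (s j))) j<k)
             (SatisfiesPath⇒Reaches l v λ i → proj₂ (All-consIf⁻ (i <? k) (proj₁ (s i)))
                                            , proj₂ (All-consIf⁻ (i ≟ᶠ k) (proj₂ (s i))))

  Reaches⇔SatisfiesPath : ∀ {T} (l : Leaf T) v → Reaches T v l ⇔ SatisfiesPath l v
  Reaches⇔SatisfiesPath l v = mk⇔ Reaches⇒SatisfiesPath (SatisfiesPath⇒Reaches l v)

  IsFlatDifferenceProduct : Pred Input 0ℓ → ℕ → Set
  IsFlatDifferenceProduct A h = Σ (Fin n → Flat) λ G → Σ (Fin n → Fin h → Flat) λ Gs →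
    ∀ v → ValidInput v → (A v ⇔ (∀ i → (v i ∈F G i) × (∀ j → ¬ (v i ∈F Gs i j))))

  empty-isFlatDifferenceProduct : ∀ {A h} → 1 ≤ n → (∀ v → ValidInput v → ¬ A v) →
                                  IsFlatDifferenceProduct A h
  empty-isFlatDifferenceProduct 1≤n ¬A = (λ _ → ∅) , (λ _ _ → ∅) , λ v valid → mk⇔
    (λ a → ⊥-elim (¬A v valid a))
    (λ s → ⊥-elim (point∉∅ (valid i₀) (proj₁ (s i₀))))
    where i₀ = fromℕ< 1≤n

  leaf-isFlatDifferenceProduct : ∀ {T h} (l : Leaf T) → depth l ≤ h →
                                 IsFlatDifferenceProduct (λ v → Reaches T v l) h
  leaf-isFlatDifferenceProduct {h = h} l d≤h =
    ⋂ ∘ mustContain l , (λ i → pad (mustAvoid l i) (bound i)) , λ v valid →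
    ⇔.trans (Reaches⇔SatisfiesPath l v) (mk⇔
      (λ s i → from (∈-⋂ _) (proj₁ (s i)) , from (∉-pad (valid i) _ (bound i)) (proj₂ (s i)))
      (λ s i → to (∈-⋂ _) (proj₁ (s i)) , to (∉-pad (valid i) _ (bound i)) (proj₂ (s i))))
    where
    open Equivalence
    bound : ∀ i → length (mustAvoid l i) ≤ h
    bound i = ≤-trans (length-mustAvoid≤depth l i) d≤h

  reachingSet-isFlatDifferenceProduct : ∀ {T h} → 1 ≤ n → QueriesAtMost h T → (l : Leaf T) →
                                        IsFlatDifferenceProduct (λ v → Reaches T v l) h
  reachingSet-isFlatDifferenceProduct {h = h} 1≤n within l with depth l ≤? h
  ... | yes d≤h = leaf-isFlatDifferenceProduct l d≤h
  ... | no  d≰h = empty-isFlatDifferenceProduct 1≤n (λ v valid r → d≰h (within v l valid r))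

lemma5p1 : (n : ℕ) → 1 ≤ n → (q : ℕ) → IsPrimePower q → (F : FiniteField q) →
    let open Setup F n in
    (h : ℕ) (T : Tree) → QueriesAtMost h T → Correct T → (l : Leaf T) →
      (Σ Hyperplane λ H → ∀ v → ValidInput v → Reaches T v l → ∀ i → v i ∈H H)
      × (Σ (Fin n → Flat) λ G → Σ (Fin n → Fin h → Flat) λ Gs →
           ∀ v → ValidInput v →
             (Reaches T v l ⇔ (∀ i → (v i ∈F G i) × (∀ j → ¬ (v i ∈F Gs i j)))))
lemma5p1 n 1≤n q _ F h T within correct l =
  (label l , λ v valid r → correct v l valid r) , reachingSet-isFlatDifferenceProduct 1≤n within l
  where open Setup F n using (label)
        open DSpan F n
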